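{- Let $N$ be an integer with $\gcd(72,N)\in\{2,3,4,6,12,18,24,36\}$ and $N\notin\{2,3,4,6\}$. Then there exists an integer $t$ such that: (C1) $\gcd(N,t)=1$ and $t\not\equiv\pm1\pmod N$; (C2) writing $\frac{t+1}{N}=\frac{n_+}{N_+}$ and $\frac{t-1}{N}=\frac{n_- }{N_- }$ with integers $N_\pm>0$ and $\gcd(n_\pm,N_\pm)=1$, there exist prime factors $p_+,p_-$ of $N$ (not necessarily distinct) such that $\gcd(p_+,N_+)=1$ and $\gcd(p_-,N_-)=1$. -}

module Defs where

{-# OPTIONS --safe #-}

-- Write N = m · c. If c ∣ t + 1 and m ∣ t − 1, then t is coprime to N, and the reduced
-- denominator of (t + 1)/N divides m while that of (t − 1)/N divides c; so a prime of c
-- not dividing m serves as p₊ and a prime factor of m not dividing c as p₋.  The gcd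
-- condition forces N = 2m or N = 4m with m odd, or else 3 ∥ N.  For N = 4m take
-- t = 2m + 1, and for N = 3m take t = m + 1 or t = 2m + 1 according as m ≡ 1 or 2 (mod 3).
-- For N = 2m take t = m + 2: then t ± 1 are even and m is odd, so p₊ = p₋ = 2.  The
-- excluded N ∈ {2, 3, 4, 6} are those for which this t would have t + 1 ≥ N.
module Submission where

module _ where
  open import Data.Empty using (⊥-elim)
  open import Data.Fin.Base using (zero; suc)
  open import Data.Integer.Base using (ℤ; +_)
  open import Data.Integer.Properties using (+-injective; pos-*)
  open import Data.List.Base using (List; _∷_; [])
  open import Data.List.Membership.Propositional using (_∈_)
  open import Data.List.Relation.Unary.All using (All; all?; lookup; head)
  open import Data.List.Relation.Unary.Any using (here; there)
  open import Data.Nat.Base hiding (_/_)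
  open import Data.Nat.Coprimality using (Coprime; coprime?; coprime-divisor; 1-coprimeTo; coprime⇒gcd≡1)
    renaming (sym to coprime-sym)
  open import Data.Nat.Divisibility
  open import Data.Nat.DivMod using (_divMod_; result)
  open import Data.Nat.GCD using (gcd; gcd-greatest; gcd[m,n]∣n)
  open import Data.Nat.ListAction using (product)
  open import Data.Nat.Primality using (Prime; prime[2]; prime?)
  open import Data.Nat.Primality.Factorisation using (factorise)
  open import Data.Nat.Properties
  open import Data.Nat.Tactic.RingSolver using (solve)
  open import Data.Product using (∃-syntax; _×_; _,_; uncurry)
  open import Data.Rational.Base using (_/_; ↧ₙ_)
  open import Data.Rational.Properties using (↧-normalize)
  open import Data.Sum.Base as Sum using (_⊎_; inj₁; inj₂)
  open import Function using (_∘_)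
  open import Relation.Binary.PropositionalEquality
  open import Relation.Nullary using (¬_; contradiction)
  open import Relation.Nullary.Decidable using (from-yes; ¬?; _⊎-dec_; _×-dec_; _→-dec_)

  coprime-+-∣ : ∀ {m r x} → Coprime m r → m ∣ x → Coprime m (r + x)
  coprime-+-∣ {r = r} {x} m⊥r m∣x {d} (d∣m , d∣r+x) =
    m⊥r (d∣m , ∣m+n∣m⇒∣n (subst (d ∣_) (+-comm r x) d∣r+x) (∣-trans d∣m m∣x))

  ∣n⇒coprime-suc : ∀ {d n} → d ∣ n → Coprime d (suc n)
  ∣n⇒coprime-suc {d} = coprime-+-∣ (coprime-sym (1-coprimeTo d))

  ∣suc⇒coprime : ∀ {d n} → d ∣ suc n → Coprime d n
  ∣suc⇒coprime {n = n} d∣1+n {e} (e∣d , e∣n) =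
    ∣1⇒≡1 (∣m+n∣m⇒∣n (subst (e ∣_) (+-comm 1 n) (∣-trans e∣d d∣1+n)) e∣n)

  coprime-∣ˡ : ∀ {d m n} → d ∣ m → Coprime m n → Coprime d n
  coprime-∣ˡ d∣m m⊥n (e∣d , e∣n) = m⊥n (∣-trans e∣d d∣m , e∣n)

  coprime-∣ʳ : ∀ {d m n} → d ∣ n → Coprime m n → Coprime m d
  coprime-∣ʳ d∣n m⊥n (e∣m , e∣d) = m⊥n (e∣m , ∣-trans e∣d d∣n)

  coprime-*ˡ : ∀ {m n o} → Coprime m o → Coprime n o → Coprime (m * n) o
  coprime-*ˡ m⊥o n⊥o (d∣mn , d∣o) =
    n⊥o (coprime-divisor (coprime-sym (coprime-∣ʳ d∣o m⊥o)) d∣mn , d∣o)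

  ∃primeFactor : ∀ n → 1 < n → ∃[ p ] (Prime p × p ∣ n)
  ∃primeFactor n 1<n with factorise n {{>-nonZero (<-trans z<s 1<n)}}
  ... | record { factors = [] ; isFactorisation = n≡1 } = contradiction n≡1 (>⇒≢ 1<n)
  ... | record { factors = p ∷ ps ; isFactorisation = n≡p*ps ; factorsPrime = all-prime } =
    p , head all-prime , divides (product ps) (trans n≡p*ps (*-comm p (product ps)))

  ↧ₙ[a/N]*gcd[a,N]≡N : ∀ a N .{{_ : NonZero N}} → ↧ₙ (+ a / N) * gcd a N ≡ N
  ↧ₙ[a/N]*gcd[a,N]≡N a N = +-injective (trans (pos-* (↧ₙ (+ a / N)) (gcd a N)) (↧-normalize a N))

  ↧ₙ-/-∣ : ∀ {a h M N} .{{_ : NonZero N}} → N ≡ M * h → h ∣ a → ↧ₙ (+ a / N) ∣ M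
  ↧ₙ-/-∣ {a} {h} {M} {N} refl h∣a = *-cancelʳ-∣ h {{m*n≢0⇒n≢0 M}} (begin
    D * h        ∣⟨ *-monoʳ-∣ D (gcd-greatest h∣a (n∣m*n M)) ⟩
    D * gcd a N  ≡⟨ ↧ₙ[a/N]*gcd[a,N]≡N a N ⟩
    M * h        ∎)
    where
      open ∣-Reasoning
      D = ↧ₙ (+ a / N)

  PrimeFactorCoprimeToDenominator : (N : ℕ) .{{_ : NonZero N}} → ℤ → Set
  PrimeFactorCoprimeToDenominator N i = ∃[ p ] (Prime p × p ∣ N × gcd p (↧ₙ (i / N)) ≡ 1)

  primeFactorCoprimeToDenominator : ∀ {p a h M N} .{{_ : NonZero N}} →
    Prime p → p ∣ N → N ≡ M * h → h ∣ a → Coprime p M → PrimeFactorCoprimeToDenominator N (+ a)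
  primeFactorCoprimeToDenominator {p} p-prime p∣N N≡M*h h∣a p⊥M =
    p , p-prime , p∣N , coprime⇒gcd≡1 (coprime-∣ʳ (↧ₙ-/-∣ N≡M*h h∣a) p⊥M)

  record Witness (N : ℕ) .{{_ : NonZero N}} : Set where
    field
      t : ℕ
      1<t : 1 < t
      t+1<N : suc t < N
      coprime : Coprime N t
      prime₊ : PrimeFactorCoprimeToDenominator N (+ suc t)
      prime₋ : PrimeFactorCoprimeToDenominator N (+ (t ∸ 1))

  witness-m·2 : ∀ {N m} .{{_ : NonZero N}} → N ≡ m * 2 → 3 < m → 2 ∣ suc m → Witness N
  witness-m·2 {m = m} refl 3<m 2∣1+m = record
    { t = 2 + m
    ; 1<t = s<s z<s
    ; t+1<N = begin-strict
        3 + m  <⟨ +-monoˡ-< m 3<m ⟩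
        m + m  ≡⟨ solve (m ∷ []) ⟩
        m * 2  ∎
    ; coprime = coprime-*ˡ (coprime-+-∣ (coprime-sym 2⊥m) ∣-refl) (∣suc⇒coprime 2∣3+m)
    ; prime₊ = primeFactorCoprimeToDenominator prime[2] (n∣m*n m) refl 2∣3+m 2⊥m
    ; prime₋ = primeFactorCoprimeToDenominator prime[2] (n∣m*n m) refl 2∣1+m 2⊥m
    }
    where
      open ≤-Reasoning
      2⊥m : Coprime 2 m
      2⊥m = ∣suc⇒coprime 2∣1+m
      2∣3+m : 2 ∣ 3 + m
      2∣3+m = ∣m∣n⇒∣m+n ∣-refl 2∣1+m

  witness-m·c : ∀ {N m c a p} .{{_ : NonZero N}} .{{_ : NonZero a}} → N ≡ m * c →
    Prime p → p ∣ c → Coprime c m → a < c → 2 < m → c ∣ 2 + a * m → Witness N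
  witness-m·c {m = m} {c} {a} refl p-prime p∣c c⊥m a<c 2<m c∣2+am
    with ∃primeFactor m (<-trans (s<s z<s) 2<m)
  ... | q , q-prime , q∣m = record
    { t = 1 + a * m
    ; 1<t = s<s (*-mono-≤ (>-nonZero⁻¹ a) (<-trans z<s (<-trans (s<s z<s) 2<m)))
    ; t+1<N = begin-strict
        2 + a * m  <⟨ +-monoˡ-< (a * m) 2<m ⟩
        m + a * m  ≤⟨ *-monoˡ-≤ m a<c ⟩
        c * m      ≡⟨ *-comm c m ⟩
        m * c      ∎
    ; coprime = coprime-*ˡ (∣n⇒coprime-suc (n∣m*n a)) (∣suc⇒coprime c∣2+am)
    ; prime₊ = primeFactorCoprimeToDenominator p-prime (∣-trans p∣c (n∣m*n m)) refl c∣2+am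
        (coprime-∣ˡ p∣c c⊥m)
    ; prime₋ = primeFactorCoprimeToDenominator q-prime (∣-trans q∣m (m∣m*n c)) (*-comm m c) (n∣m*n a)
        (coprime-∣ˡ q∣m (coprime-sym c⊥m))
    }
    where open ≤-Reasoning

  witness-[3+2j]·4 : ∀ {N} j .{{_ : NonZero N}} → N ≡ (3 + j * 2) * 4 → Witness N
  witness-[3+2j]·4 j N≡m*4 = witness-m·c {a = 2} N≡m*4 prime[2] (divides 2 refl)
    (coprime-*ˡ 2⊥m 2⊥m) (s<s (s<s z<s)) (s<s (s<s z<s)) (divides (2 + j) (solve (j ∷ [])))
    where
      2⊥m : Coprime 2 (3 + j * 2)
      2⊥m = ∣suc⇒coprime (n∣m*n (2 + j))

  witness-[4+3j]·3 : ∀ {N} j .{{_ : NonZero N}} → N ≡ (4 + j * 3) * 3 → Witness N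
  witness-[4+3j]·3 j N≡m*3 = witness-m·c {a = 1} N≡m*3 (from-yes (prime? 3)) ∣-refl
    (∣n⇒coprime-suc (n∣m*n (1 + j))) (s<s z<s) (s<s (s<s z<s)) (divides (2 + j) (solve (j ∷ [])))

  witness-[5+3j]·3 : ∀ {N} j .{{_ : NonZero N}} → N ≡ (5 + j * 3) * 3 → Witness N
  witness-[5+3j]·3 j N≡m*3 = witness-m·c {a = 2} N≡m*3 (from-yes (prime? 3)) ∣-refl
    (∣suc⇒coprime (n∣m*n (2 + j))) (s<s (s<s z<s)) (s<s (s<s z<s)) (divides (4 + j * 2) (solve (j ∷ [])))

  2-adic-cases : ∀ N → (∃[ k ] N ≡ (1 + k * 2) * 2) ⊎ (∃[ k ] N ≡ (1 + k * 2) * 4) ⊎ Coprime 2 N ⊎ 8 ∣ N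
  2-adic-cases N with N divMod 2
  2-adic-cases _ | result q (suc zero) refl = inj₂ (inj₂ (inj₁ (∣n⇒coprime-suc (n∣m*n q))))
  2-adic-cases _ | result q zero refl with q divMod 2
  ... | result k (suc zero) refl = inj₁ (k , refl)
  ... | result q′ zero refl with q′ divMod 2
  ...   | result k (suc zero) refl = inj₂ (inj₁ (k , *-assoc (1 + k * 2) 2 2))
  ...   | result k zero refl = inj₂ (inj₂ (inj₂ (divides k (trans (*-assoc (k * 2) 2 2) (*-assoc k 2 4)))))

  3-adic-cases : ∀ {N} → 3 ∣ N → ¬ 9 ∣ N → (∃[ k ] N ≡ (1 + k * 3) * 3) ⊎ (∃[ k ] N ≡ (2 + k * 3) * 3)
  3-adic-cases (divides q refl) 9∤N with q divMod 3
  ... | result k zero refl = ⊥-elim (9∤N (divides k (*-assoc k 3 3)))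
  ... | result k (suc zero) refl = inj₁ (k , refl)
  ... | result k (suc (suc zero)) refl = inj₂ (k , refl)

  admissibleGcds : List ℕ
  admissibleGcds = 2 ∷ 3 ∷ 4 ∷ 6 ∷ 12 ∷ 18 ∷ 24 ∷ 36 ∷ []

  3∥admissibleGcd : All (λ g → Coprime 2 g ⊎ 8 ∣ g → 3 ∣ g × ¬ 9 ∣ g) admissibleGcds
  3∥admissibleGcd =
    from-yes (all? (λ g → (coprime? 2 g ⊎-dec 8 ∣? g) →-dec (3 ∣? g ×-dec ¬? (9 ∣? g))) admissibleGcds)

  gcd[72,N]∈⇒3∥N : ∀ {N} → gcd 72 N ∈ admissibleGcds → Coprime 2 N ⊎ 8 ∣ N → 3 ∣ N × ¬ 9 ∣ N
  gcd[72,N]∈⇒3∥N {N} g∈ 2⊥N⊎8∣N =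
    let 3∣g , 9∤g = lookup 3∥admissibleGcd g∈
                      (Sum.map (coprime-∣ʳ g∣N) (gcd-greatest (divides 9 refl)) 2⊥N⊎8∣N)
    in ∣-trans 3∣g g∣N , 9∤g ∘ gcd-greatest (divides 8 refl)
    where
      g∣N : gcd 72 N ∣ N
      g∣N = gcd[m,n]∣n 72 N

  witness : ∀ N .{{_ : NonZero N}} → gcd 72 N ∈ admissibleGcds →
    ¬ N ∈ (2 ∷ 3 ∷ 4 ∷ 6 ∷ []) → Witness N
  witness N g∈ N∉ with 2-adic-cases N
  ... | inj₁ (0 , N≡2) = ⊥-elim (N∉ (here N≡2))
  ... | inj₁ (1 , N≡6) = ⊥-elim (N∉ (there (there (there (here N≡6)))))
  ... | inj₁ (suc (suc j) , N≡m*2) = witness-m·2 N≡m*2 (s<s (s<s (s<s z<s))) (n∣m*n (3 + j))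
  ... | inj₂ (inj₁ (0 , N≡4)) = ⊥-elim (N∉ (there (there (here N≡4))))
  ... | inj₂ (inj₁ (suc j , N≡m*4)) = witness-[3+2j]·4 j N≡m*4
  ... | inj₂ (inj₂ 2⊥N⊎8∣N) with uncurry 3-adic-cases (gcd[72,N]∈⇒3∥N g∈ 2⊥N⊎8∣N)
  ...   | inj₁ (0 , N≡3) = ⊥-elim (N∉ (there (here N≡3)))
  ...   | inj₁ (suc j , N≡m*3) = witness-[4+3j]·3 j N≡m*3
  ...   | inj₂ (0 , N≡6) = ⊥-elim (N∉ (there (there (there (here N≡6)))))
  ...   | inj₂ (suc j , N≡m*3) = witness-[5+3j]·3 j N≡m*3

open import Defs
open import Data.Nat using (ℕ; NonZero)
open import Data.Nat.GCD using () renaming (gcd to gcdℕ)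
open import Data.Nat.Divisibility using () renaming (_∣_ to _∣ℕ_)
open import Data.Nat.Primality using (Prime)
open import Data.Integer using (ℤ; +_; _+_; _-_; 1ℤ)
open import Data.Integer.GCD using (gcd)
open import Data.Integer.Divisibility using (_∣_)
open import Data.Rational using (_/_; ↧ₙ_)
open import Data.List using (_∷_; [])
open import Data.List.Membership.Propositional using (_∈_)
open import Data.Product using (Σ; _×_; ∃-syntax)
open import Relation.Nullary using (¬_)
open import Relation.Binary.PropositionalEquality using (_≡_)

import Data.Nat as ℕ
import Data.Nat.Properties as ℕ
open import Data.Nat.Coprimality using (coprime⇒gcd≡1)
open import Data.Nat.Divisibility using (>⇒∤)
open import Data.Integer.Properties using (⊖-≥)
open import Data.Product using (_,_)
open import Relation.Binary.PropositionalEquality using (cong; sym; subst)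

¬+∣+ : ∀ {N x} → 0 ℕ.< x → x ℕ.< N → ¬ (+ N ∣ + x)
¬+∣+ 0<x x<N = >⇒∤ {{ℕ.>-nonZero 0<x}} x<N

lemma4p4 : (N : ℕ) → .{{_ : NonZero N}} →
           gcdℕ 72 N ∈ (2 ∷ 3 ∷ 4 ∷ 6 ∷ 12 ∷ 18 ∷ 24 ∷ 36 ∷ []) →
           ¬ (N ∈ (2 ∷ 3 ∷ 4 ∷ 6 ∷ [])) →
           ∃[ t ] (
             -- (C1)
             (gcd (+ N) t ≡ 1ℤ) × ¬ ((+ N) ∣ (t - 1ℤ)) × ¬ ((+ N) ∣ (t + 1ℤ)) ×
             -- (C2): N₊ = ↧ₙ ((t + 1) / N), N₋ = ↧ₙ ((t - 1) / N) (reduced denominators)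
             (∃[ p₊ ] (Prime p₊ × p₊ ∣ℕ N × gcdℕ p₊ (↧ₙ ((t + 1ℤ) / N)) ≡ 1)) ×
             (∃[ p₋ ] (Prime p₋ × p₋ ∣ℕ N × gcdℕ p₋ (↧ₙ ((t - 1ℤ) / N)) ≡ 1)))
lemma4p4 N g∈ N∉ =
  + t , cong +_ (coprime⇒gcd≡1 coprime) ,
  subst (λ i → ¬ (+ N ∣ i)) (sym +t-1≡+[t∸1])
    (¬+∣+ (ℕ.m<n⇒0<n∸m 1<t) (ℕ.≤-<-trans (ℕ.m∸n≤m t 1) (ℕ.<-trans (ℕ.n<1+n t) t+1<N))) ,
  subst (λ i → ¬ (+ N ∣ i)) (sym +t+1≡+[1+t]) (¬+∣+ ℕ.z<s t+1<N) ,
  subst (PrimeFactorCoprimeToDenominator N) (sym +t+1≡+[1+t]) prime₊ ,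
  subst (PrimeFactorCoprimeToDenominator N) (sym +t-1≡+[t∸1]) prime₋
  where
    open Witness (witness N g∈ N∉)
    +t+1≡+[1+t] : + t + 1ℤ ≡ + ℕ.suc t
    +t+1≡+[1+t] = cong +_ (ℕ.+-comm t 1)
    +t-1≡+[t∸1] : + t - 1ℤ ≡ + (t ℕ.∸ 1)
    +t-1≡+[t∸1] = ⊖-≥ (ℕ.<⇒≤ 1<t)
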